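{- For $n\ge1$ let $M_n$ be the number of maximal elements of the poset $(V(\mathcal{R}_n),\le)$. Then $$\sum_{n\ge1}M_nt^n=\frac{t(1+2t-2t^3+t^5+t^6)}{1-2t^2-t^3+t^4+t^5-t^7}.$$
   Context: A binary string is run-constrained if every run of 1s in it is immediately followed by a run of 0s of strictly greater length (the empty string counts as run-constrained). For $n\ge1$ the Fibonacci-run graph $\mathcal{R}_n$ has vertex set $\{w\in\{0,1\}^n : w00 \text{ is run-constrained}\}$, two vertices being adjacent iff they differ in exactly one coordinate. The poset $(V(\mathcal{R}_n),\le)$ is defined by the covering relation: $v$ covers $u$ iff $u,v\in V(\mathcal{R}_n)$ and $v$ is obtained from $u$ by changing a single 0 into a 1; $\le$ is the reflexive-transitive closure of this relation. An element is maximal if no other element is greater than it. -}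

module Defs where

open import Data.Bool using (Bool; true; false; _∧_; T)
open import Data.Nat using (ℕ; zero; suc; _<ᵇ_)
open import Data.Integer using (ℤ; +_; -[1+_]; _+_; _*_)
open import Data.List using (List; []; _∷_; _++_)
open import Data.Vec using (Vec; toList; lookup; _[_]≔_)
open import Data.Fin using (Fin)
open import Data.Product using (Σ; ∃; _×_; proj₁)
open import Relation.Binary.PropositionalEquality using (_≡_)
open import Relation.Binary.Construct.Closure.ReflexiveTransitive using (Star)

-- Run-constrained binary strings (true = 1, false = 0).
-- A left-to-right scan:
--   * leadingZeros : zeros before the first 1 (unconstrained);
--   * ones k       : currently inside a run of 1s, k ones read so far;
--   * zeros k j    : inside the run of 0s following a run of k ones,
--                    j zeros read so far.  When this 0-run ends (at the
--                    end of the string or at the next 1) we require k < j.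

mutual
  ones : ℕ → List Bool → Bool
  ones k []            = false
  ones k (true  ∷ w)   = ones (suc k) w
  ones k (false ∷ w)   = zeros k 1 w

  zeros : ℕ → ℕ → List Bool → Bool
  zeros k j []          = k <ᵇ j
  zeros k j (false ∷ w) = zeros k (suc j) w
  zeros k j (true  ∷ w) = (k <ᵇ j) ∧ ones 1 w

leadingZeros : List Bool → Bool
leadingZeros []          = true
leadingZeros (false ∷ w) = leadingZeros w
leadingZeros (true  ∷ w) = ones 1 w

RunConstrained : List Bool → Set
RunConstrained w = T (leadingZeros w)

IsVertex : (n : ℕ) → Vec Bool n → Set
IsVertex n w = RunConstrained (toList w ++ (false ∷ false ∷ []))

Vertex : ℕ → Set
Vertex n = Σ (Vec Bool n) (IsVertex n)

Covers : (n : ℕ) → Vertex n → Vertex n → Set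
Covers n u v = ∃ λ (i : Fin n) →
  (lookup (proj₁ u) i ≡ false) × (proj₁ v ≡ (proj₁ u [ i ]≔ true))

Leq : (n : ℕ) → Vertex n → Vertex n → Set
Leq n u v = Star (Covers n) u v

Maximal : (n : ℕ) → Vertex n → Set
Maximal n u = (v : Vertex n) → Leq n u v → proj₁ v ≡ proj₁ u

-- Formal power series over ℤ (as coefficient sequences) and their
-- Cauchy product.

sumUpTo : ℕ → (ℕ → ℤ) → ℤ
sumUpTo zero    f = f 0
sumUpTo (suc n) f = sumUpTo n f + f (suc n)

cauchy : (ℕ → ℤ) → (ℕ → ℤ) → ℕ → ℤ
cauchy f g n = sumUpTo n (λ k → f k * g (n Data.Nat.∸ k))

-- Numerator  t(1+2t-2t^3+t^5+t^6) = t + 2t^2 - 2t^4 + t^6 + t^7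
numer : ℕ → ℤ
numer 1 = + 1
numer 2 = + 2
numer 4 = -[1+ 1 ]
numer 6 = + 1
numer 7 = + 1
numer _ = + 0

denom : ℕ → ℤ
denom 0 = + 1
denom 2 = -[1+ 1 ]
denom 3 = -[1+ 0 ]
denom 4 = + 1
denom 5 = + 1
denom 7 = -[1+ 0 ]
denom _ = + 0

seriesFrom1 : (ℕ → ℕ) → ℕ → ℤ
seriesFrom1 M zero    = + 0
seriesFrom1 M (suc n) = + M (suc n)

module Submission where

-- A vertex is maximal iff it has no upper cover, i.e. iff no single 0 → 1 flip of w keeps
-- w00 run-constrained. Reading w00 as a few leading zeros followed by blocks 1ᵏ0ʲ, this
-- means: every block has j = k + 1 (odd length) or j = k + 2 (even length), an even block is
-- followed by an odd one, and there are at most two leading zeros, after which the first block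
-- is odd. Such words arise from shorter ones by prefixing the block 100 or 1000, or by adding
-- a one and a zero to the first block; so the numbers o(n), e(n) of words whose first block is
-- odd, even satisfy o(n+3) = o(n) + e(n) + o(n+1) and e(n+4) = o(n) + e(n+2), and
-- Mₙ = o(n) + e(n) + o(n−1) + o(n−2). The characteristic polynomial of this system is
-- (1 − t² − t³)(1 − t²) − t⁷, the denominator, and the numerator is fixed by M₁, …, M₈.
-- The characterisation is proved by running an automaton for run-constrained words on w00
-- together with all of its single flips.

open import Defs
open import Algebra.Bundles using (CommutativeMonoid)
open import Data.Bool using (Bool; true; false; _∧_; _∨_; not; if_then_else_)
open import Data.Bool.Properties
  using (∧-identityʳ; ∧-conicalˡ; ∧-conicalʳ; ∨-zeroʳ; ∧-distribʳ-∨; ∧-commutativeMonoid; not-¬; T-≡)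
open import Algebra.Properties.CommutativeSemigroup (CommutativeMonoid.commutativeSemigroup ∧-commutativeMonoid)
  using (xy∙z≈xz∙y)
open import Data.Nat using (ℕ; zero; suc; _≡ᵇ_; _<ᵇ_; _≤_; z≤n; s≤s; s≤s⁻¹)
open import Data.Nat.Properties using (≤-trans; n≤1+n; <⇒≱; <ᵇ⇒<)
open import Data.List using (List; []; _∷_; _++_; map; length)
open import Data.List.Properties using (length-++; length-map)
open import Data.List.Membership.Propositional using (_∈_)
open import Data.List.Membership.Propositional.Properties using (∈-map⁺; ∈-++⁺ˡ; ∈-++⁺ʳ)
open import Data.List.Relation.Unary.Any using (here)
open import Data.List.Relation.Unary.All as All using (All; []; _∷_)
import Data.List.Relation.Unary.All.Properties as All
open import Data.List.Relation.Unary.AllPairs using ([]; _∷_)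
open import Data.List.Relation.Unary.Unique.Propositional using (Unique)
import Data.List.Relation.Unary.Unique.Propositional.Properties as Unique
open import Data.List.Relation.Binary.Disjoint.Propositional using (Disjoint)
open import Data.Vec using (Vec; []; _∷_; toList; tail; lookup; _[_]≔_) renaming (_++_ to _++ᵛ_)
open import Data.Vec.Properties using (lookup∘update; ++-injectiveʳ; ∷-injectiveʳ)
open import Data.Fin using (Fin; zero; suc)
open import Data.Product using (Σ; _×_; _,_; proj₁)
open import Data.Empty using (⊥-elim)
open import Function.Bundles using (_⇔_; mk⇔; Equivalence)
import Function.Properties.Equivalence as ⇔
open import Relation.Nullary using (¬_)
open import Relation.Binary.PropositionalEquality
open import Relation.Binary.Construct.Closure.ReflexiveTransitive using (ε; _◅_)

open Equivalence using (to; from)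

-- Run-constrained words and maximal vertices

data State : Set where
  leading : State
  inOnes  : ℕ → State
  inZeros : ℕ → ℕ → State
  dead    : State

step : State → Bool → State
step leading       false = leading
step leading       true  = inOnes 1
step (inOnes k)    true  = inOnes (suc k)
step (inOnes k)    false = inZeros k 1
step (inZeros k j) false = inZeros k (suc j)
step (inZeros k j) true  = if k <ᵇ j then inOnes 1 else dead
step dead          _     = dead

accepting : State → Bool
accepting leading       = true
accepting (inOnes _)    = false
accepting (inZeros k j) = k <ᵇ j
accepting dead          = false

accepts : State → List Bool → Bool
accepts s []      = accepting s
accepts s (b ∷ x) = accepts (step s b) x

accepts-dead : ∀ x → accepts dead x ≡ false
accepts-dead []      = refl
accepts-dead (_ ∷ x) = accepts-dead x

mutual
  ones≡accepts : ∀ k x → ones k x ≡ accepts (inOnes k) x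
  ones≡accepts k []          = refl
  ones≡accepts k (true ∷ x)  = ones≡accepts (suc k) x
  ones≡accepts k (false ∷ x) = zeros≡accepts k 1 x

  zeros≡accepts : ∀ k j x → zeros k j x ≡ accepts (inZeros k j) x
  zeros≡accepts k j []          = refl
  zeros≡accepts k j (false ∷ x) = zeros≡accepts k (suc j) x
  zeros≡accepts k j (true ∷ x) with k <ᵇ j
  ... | true  = ones≡accepts 1 x
  ... | false = sym (accepts-dead x)

leadingZeros≡accepts : ∀ x → leadingZeros x ≡ accepts leading x
leadingZeros≡accepts []          = refl
leadingZeros≡accepts (false ∷ x) = leadingZeros≡accepts x
leadingZeros≡accepts (true ∷ x)  = ones≡accepts 1 x

infixl 5 _·00
_·00 : List Bool → List Bool
w ·00 = w ++ false ∷ false ∷ []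

isVertex⇔accepts : ∀ n (w : Vec Bool n) → IsVertex n w ⇔ (accepts leading (toList w ·00) ≡ true)
isVertex⇔accepts n w =
  mk⇔ (λ p → trans (sym (leadingZeros≡accepts (toList w ·00))) (to T-≡ p))
      (λ p → from T-≡ (trans (leadingZeros≡accepts (toList w ·00)) p))

-- The conjunct on a 0 rejects the word with that 0 flipped to 1, read from the same state.
acceptsMaximal : State → List Bool → Bool
acceptsMaximal s []          = accepts s (false ∷ false ∷ [])
acceptsMaximal s (true ∷ w)  = acceptsMaximal (step s true) w
acceptsMaximal s (false ∷ w) = acceptsMaximal (step s false) w ∧ not (accepts (step s true) (w ·00))

acceptsMaximal-dead : ∀ w → acceptsMaximal dead w ≡ false
acceptsMaximal-dead []          = refl
acceptsMaximal-dead (true ∷ w)  = acceptsMaximal-dead w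
acceptsMaximal-dead (false ∷ w) rewrite acceptsMaximal-dead w = refl

FlipsRejected : ∀ {n} → State → Vec Bool n → Set
FlipsRejected {n} s w = ∀ (i : Fin n) → lookup w i ≡ false → accepts s (toList (w [ i ]≔ true) ·00) ≡ false

acceptsMaximal⇒ : ∀ {n} s (w : Vec Bool n) → acceptsMaximal s (toList w) ≡ true →
                  accepts s (toList w ·00) ≡ true × FlipsRejected s w
acceptsMaximal⇒ s [] p = p , λ ()
acceptsMaximal⇒ s (true ∷ w) p with acceptsMaximal⇒ (step s true) w p
... | acc , rej = acc , λ { zero () ; (suc i) → rej i }
acceptsMaximal⇒ s (false ∷ w) p with acceptsMaximal⇒ (step s false) w (∧-conicalˡ _ _ p)
... | acc , rej = acc , λ { zero _ → flipRejected ; (suc i) → rej i }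
  where
  flipRejected : accepts (step s true) (toList w ·00) ≡ false
  flipRejected with accepts (step s true) (toList w ·00) | ∧-conicalʳ (acceptsMaximal (step s false) (toList w)) _ p
  ... | false | _ = refl

acceptsMaximal⇐ : ∀ {n} s (w : Vec Bool n) → accepts s (toList w ·00) ≡ true → FlipsRejected s w →
                  acceptsMaximal s (toList w) ≡ true
acceptsMaximal⇐ s []          acc rej = acc
acceptsMaximal⇐ s (true ∷ w)  acc rej = acceptsMaximal⇐ (step s true) w acc (λ i → rej (suc i))
acceptsMaximal⇐ s (false ∷ w) acc rej
  rewrite acceptsMaximal⇐ (step s false) w acc (λ i → rej (suc i)) | rej zero refl = refl

covers⇒changes : ∀ {n} {u v : Vertex n} → Covers n u v → proj₁ v ≢ proj₁ u
covers⇒changes {u = u , _} (i , uᵢ≡0 , refl) v≡u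
  with trans (sym (lookup∘update i u true)) (trans (cong (λ x → lookup x i) v≡u) uᵢ≡0)
... | ()

maximal⇔noCover : ∀ {n} (u : Vertex n) → Maximal n u ⇔ (∀ v → ¬ Covers n u v)
maximal⇔noCover {n} u = mk⇔ (λ max v c → covers⇒changes {u = u} {v} c (max v (c ◅ ε))) noCover⇒maximal
  where
  noCover⇒maximal : (∀ v → ¬ Covers n u v) → Maximal n u
  noCover⇒maximal none v ε       = refl
  noCover⇒maximal none v (_◅_ {j = v′} c _) = ⊥-elim (none v′ c)

noCover⇔flipsRejected : ∀ {n} (w : Vec Bool n) (p : IsVertex n w) →
                        (∀ v → ¬ Covers n (w , p) v) ⇔ FlipsRejected leading w
noCover⇔flipsRejected {n} w p = mk⇔ noCover⇒rejected rejected⇒noCover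
  where
  noCover⇒rejected : (∀ v → ¬ Covers n (w , p) v) → FlipsRejected leading w
  noCover⇒rejected none i wᵢ≡0 with accepts leading (toList (w [ i ]≔ true) ·00) in acc
  ... | false = refl
  ... | true  = ⊥-elim (none (w [ i ]≔ true , from (isVertex⇔accepts n (w [ i ]≔ true)) acc) (i , wᵢ≡0 , refl))

  rejected⇒noCover : FlipsRejected leading w → ∀ v → ¬ Covers n (w , p) v
  rejected⇒noCover rej (v , q) (i , wᵢ≡0 , refl) with trans (sym (rej i wᵢ≡0)) (to (isVertex⇔accepts n v) q)
  ... | ()

maximalVertex⇔acceptsMaximal : ∀ n (w : Vec Bool n) →
  (Σ (IsVertex n w) λ p → Maximal n (w , p)) ⇔ (acceptsMaximal leading (toList w) ≡ true)
maximalVertex⇔acceptsMaximal n w = mk⇔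
  (λ (p , max) → acceptsMaximal⇐ leading w (to (isVertex⇔accepts n w) p)
                   (to (noCover⇔flipsRejected w p) (to (maximal⇔noCover (w , p)) max)))
  (λ m → let acc , rej = acceptsMaximal⇒ leading w m
             p = from (isVertex⇔accepts n w) acc
         in p , from (maximal⇔noCover (w , p)) (from (noCover⇔flipsRejected w p) rej))

-- The block structure of maximal words

data Parity : Set where
  odd even any : Parity

-- A block 1ᵏ0ʲ of a maximal word has j = k + 1 (odd length) or j = k + 2 (even length) ...
fits : Parity → ℕ → ℕ → Bool
fits odd  k j = j ≡ᵇ suc k
fits even k j = j ≡ᵇ suc (suc k)
fits any  k j = fits odd k j ∨ fits even k j

-- ... and an even block is followed by an odd one.
nextParity : ℕ → ℕ → Parity
nextParity k j = if j ≡ᵇ suc (suc k) then odd else any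

-- blocks₁ p k x and blocks₀ p k j x: the current block of parity p starts 1ᵏ resp. 1ᵏ0ʲ,
-- and appending x to what has been read gives a sequence of blocks.
mutual
  blocks₁ : Parity → ℕ → List Bool → Bool
  blocks₁ p k []          = false
  blocks₁ p k (true ∷ x)  = blocks₁ p (suc k) x
  blocks₁ p k (false ∷ x) = blocks₀ p k 1 x

  blocks₀ : Parity → ℕ → ℕ → List Bool → Bool
  blocks₀ p k j []          = fits p k j
  blocks₀ p k j (false ∷ x) = blocks₀ p k (suc j) x
  blocks₀ p k j (true ∷ x)  = fits p k j ∧ blocks₁ (nextParity k j) 1 x

-- blocks₀ any, except that a block ending right after the zeros read so far
-- does not constrain the parity of the next block.
relaxedBlocks₀ : ℕ → ℕ → List Bool → Bool
relaxedBlocks₀ k j []          = fits any k j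
relaxedBlocks₀ k j (false ∷ x) = blocks₀ any k (suc j) x
relaxedBlocks₀ k j (true ∷ x)  = fits any k j ∧ blocks₁ any 1 x

-- The index is the number of leading zeros already read; after one the first block must be odd.
maxWord₀ maxWord₁ maxWord₂ : List Bool → Bool
maxWord₀ []          = true
maxWord₀ (true ∷ x)  = blocks₁ any 1 x
maxWord₀ (false ∷ x) = maxWord₁ x

maxWord₁ []          = true
maxWord₁ (true ∷ x)  = blocks₁ odd 1 x
maxWord₁ (false ∷ x) = maxWord₂ x

maxWord₂ []          = true
maxWord₂ (true ∷ x)  = blocks₁ odd 1 x
maxWord₂ (false ∷ x) = false

fits⇒<ᵇ : ∀ p k j → fits p k j ≡ true → (k <ᵇ j) ≡ true
fits⇒<ᵇ p    zero    (suc j) _ = refl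
fits⇒<ᵇ odd  (suc k) (suc j) q = fits⇒<ᵇ odd k j q
fits⇒<ᵇ even (suc k) (suc j) q = fits⇒<ᵇ even k j q
fits⇒<ᵇ any  (suc k) (suc j) q = fits⇒<ᵇ any k j q
fits⇒<ᵇ odd  _       zero    ()
fits⇒<ᵇ even _       zero    ()
fits⇒<ᵇ any  _       zero    ()

fits⇒≤ : ∀ p k j → fits p k j ≡ true → j ≤ suc (suc k)
fits⇒≤ p    _       zero                _ = z≤n
fits⇒≤ p    zero    (suc zero)          _ = s≤s z≤n
fits⇒≤ p    zero    (suc (suc zero))    _ = s≤s (s≤s z≤n)
fits⇒≤ odd  (suc k) (suc j)             q = s≤s (fits⇒≤ odd k j q)
fits⇒≤ even (suc k) (suc j)             q = s≤s (fits⇒≤ even k j q)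
fits⇒≤ any  (suc k) (suc j)             q = s≤s (fits⇒≤ any k j q)
fits⇒≤ odd  zero    (suc (suc (suc j))) ()
fits⇒≤ even zero    (suc (suc (suc j))) ()
fits⇒≤ any  zero    (suc (suc (suc j))) ()

fits-odd : ∀ k j → fits odd k j ≡ fits any k j ∧ not (suc k <ᵇ j)
fits-odd zero    zero                = refl
fits-odd zero    (suc zero)          = refl
fits-odd zero    (suc (suc zero))    = refl
fits-odd zero    (suc (suc (suc j))) = refl
fits-odd (suc k) zero                = refl
fits-odd (suc k) (suc j)             = fits-odd k j

fits-any : ∀ k j → fits any k (suc j) ≡ (k <ᵇ suc j) ∧ not (suc k <ᵇ j)
fits-any zero    zero             = refl
fits-any zero    (suc zero)       = refl
fits-any zero    (suc (suc j))    = refl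
fits-any (suc k) zero             = refl
fits-any (suc k) (suc j)          = fits-any k j

nextParity-odd : ∀ k j → (k <ᵇ j) ≡ true → fits any k (suc j) ≡ true → nextParity k (suc j) ≡ odd
nextParity-odd zero    (suc zero)    _ _ = refl
nextParity-odd zero    (suc (suc j)) _ ()
nextParity-odd (suc k) (suc j)       p q = nextParity-odd k j p q

nextParity-any : ∀ k j → (k <ᵇ j) ≡ false → nextParity k (suc j) ≡ any
nextParity-any zero    zero    _ = refl
nextParity-any (suc k) zero    _ = refl
nextParity-any (suc k) (suc j) p = nextParity-any k j p

mutual
  blocks₁⇒accepts : ∀ p k y → blocks₁ p k y ≡ true → accepts (inOnes k) y ≡ true
  blocks₁⇒accepts p k (true ∷ y)  q = blocks₁⇒accepts p (suc k) y q
  blocks₁⇒accepts p k (false ∷ y) q = blocks₀⇒accepts p k 1 y q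

  blocks₀⇒accepts : ∀ p k j y → blocks₀ p k j y ≡ true → accepts (inZeros k j) y ≡ true
  blocks₀⇒accepts p k j []          q = fits⇒<ᵇ p k j q
  blocks₀⇒accepts p k j (false ∷ y) q = blocks₀⇒accepts p k (suc j) y q
  blocks₀⇒accepts p k j (true ∷ y)  q rewrite fits⇒<ᵇ p k j (∧-conicalˡ _ _ q) =
    blocks₁⇒accepts (nextParity k j) 1 y (∧-conicalʳ (fits p k j) _ q)

blocks₀⇒≤ : ∀ p k j y → blocks₀ p k j y ≡ true → j ≤ suc (suc k)
blocks₀⇒≤ p k j []          q = fits⇒≤ p k j q
blocks₀⇒≤ p k j (false ∷ y) q = ≤-trans (n≤1+n j) (blocks₀⇒≤ p k (suc j) y q)
blocks₀⇒≤ p k j (true ∷ y)  q = fits⇒≤ p k j (∧-conicalˡ _ _ q)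

blocks₀-tooLong : ∀ p k j y → (k <ᵇ j) ≡ true → blocks₀ p k (suc (suc j)) y ≡ false
blocks₀-tooLong p k j y k<j with blocks₀ p k (suc (suc j)) y in q
... | false = refl
... | true  = ⊥-elim (<⇒≱ (<ᵇ⇒< k j (from T-≡ k<j)) (s≤s⁻¹ (s≤s⁻¹ (blocks₀⇒≤ p k _ y q))))

mutual
  blocks₁-odd : ∀ k y → blocks₁ odd k y ≡ blocks₁ any k y ∧ not (accepts (inOnes (suc k)) y)
  blocks₁-odd k []          = refl
  blocks₁-odd k (true ∷ y)  = blocks₁-odd (suc k) y
  blocks₁-odd k (false ∷ y) = blocks₀-odd k 1 y

  blocks₀-odd : ∀ k j y → blocks₀ odd k j y ≡ blocks₀ any k j y ∧ not (accepts (inZeros (suc k) j) y)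
  blocks₀-odd k j []          = fits-odd k j
  blocks₀-odd k j (false ∷ y) = blocks₀-odd k (suc j) y
  blocks₀-odd k j (true ∷ y) =
    trans (cong (_∧ next) (fits-odd k j))
          (flipCase (fits any k j) (suc k <ᵇ j) next (blocks₁⇒accepts (nextParity k j) 1 y))
    where
    next : Bool
    next = blocks₁ (nextParity k j) 1 y
    flipCase : ∀ a c b → (b ≡ true → accepts (inOnes 1) y ≡ true) →
               (a ∧ not c) ∧ b ≡ (a ∧ b) ∧ not (accepts (if c then inOnes 1 else dead) y)
    flipCase false _     _     _ = refl
    flipCase true  false false _ = refl
    flipCase true  true  false _ = refl
    flipCase true  false true  _ rewrite accepts-dead y = refl
    flipCase true  true  true  h rewrite h refl = refl

-- Rejecting the flip of the last zero read is exactly the parity constraint dropped by relaxedBlocks₀.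
relaxedBlocks₀-lastFlip : ∀ k j y →
  relaxedBlocks₀ k (suc j) y ∧ not (accepts (step (inZeros k j) true) y) ≡ blocks₀ any k (suc j) y
relaxedBlocks₀-lastFlip k j y with k <ᵇ j in k<j
relaxedBlocks₀-lastFlip k j []          | false = ∧-identityʳ _
relaxedBlocks₀-lastFlip k j (false ∷ y) | false rewrite accepts-dead y = ∧-identityʳ _
relaxedBlocks₀-lastFlip k j (true ∷ y)  | false rewrite accepts-dead y | nextParity-any k j k<j = ∧-identityʳ _
relaxedBlocks₀-lastFlip k j []          | true  = ∧-identityʳ _
relaxedBlocks₀-lastFlip k j (false ∷ y) | true  rewrite blocks₀-tooLong any k j y k<j = refl
relaxedBlocks₀-lastFlip k j (true ∷ y)  | true  with fits any k (suc j) in fit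
... | false = refl
... | true rewrite nextParity-odd k j k<j fit = sym (blocks₁-odd 1 y)

relaxedBlocks₀-oneZero : ∀ k y → relaxedBlocks₀ (suc k) 1 y ≡ blocks₀ any (suc k) 1 y
relaxedBlocks₀-oneZero k []          = refl
relaxedBlocks₀-oneZero k (false ∷ y) = refl
relaxedBlocks₀-oneZero k (true ∷ y)  = refl

-- The state after reading 1ᵏ0ʲ⁺¹ with the first of these zeros flipped.
firstZeroFlipped : ℕ → ℕ → State
firstZeroFlipped k zero    = inOnes (suc k)
firstZeroFlipped k (suc j) = inZeros (suc k) (suc j)

step-firstZeroFlipped : ∀ k j → step (firstZeroFlipped k j) false ≡ firstZeroFlipped k (suc j)
step-firstZeroFlipped k zero    = refl
step-firstZeroFlipped k (suc j) = refl

mutual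
  acceptsMaximal-inOnes : ∀ k w → acceptsMaximal (inOnes (suc k)) w ≡ blocks₁ any (suc k) (w ·00)
  acceptsMaximal-inOnes zero    []          = refl
  acceptsMaximal-inOnes (suc k) []          = refl
  acceptsMaximal-inOnes k       (true ∷ w)  = acceptsMaximal-inOnes (suc k) w
  acceptsMaximal-inOnes k       (false ∷ w) =
    trans (acceptsMaximal-inZeros k 0 w) (relaxedBlocks₀-oneZero k (w ·00))

  -- The invariant adds the rejection of the flip that lengthens the current run of ones.
  acceptsMaximal-inZeros : ∀ k j w →
    acceptsMaximal (inZeros (suc k) (suc j)) w ∧ not (accepts (firstZeroFlipped (suc k) j) (w ·00))
      ≡ relaxedBlocks₀ (suc k) (suc j) (w ·00)
  acceptsMaximal-inZeros k zero    [] = sym (fits-any (suc k) 2)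
  acceptsMaximal-inZeros k (suc j) [] = sym (fits-any (suc k) (suc (suc (suc j))))
  acceptsMaximal-inZeros k j (false ∷ w) = begin
    (zerosRead ∧ lastFlipRejected) ∧ not (accepts (step (firstZeroFlipped (suc k) j) false) (w ·00))
      ≡⟨ xy∙z≈xz∙y zerosRead lastFlipRejected _ ⟩
    (zerosRead ∧ not (accepts (step (firstZeroFlipped (suc k) j) false) (w ·00))) ∧ lastFlipRejected
      ≡⟨ cong (λ s → (zerosRead ∧ not (accepts s (w ·00))) ∧ lastFlipRejected) (step-firstZeroFlipped (suc k) j) ⟩
    (zerosRead ∧ not (accepts (firstZeroFlipped (suc k) (suc j)) (w ·00))) ∧ lastFlipRejected
      ≡⟨ cong (_∧ lastFlipRejected) (acceptsMaximal-inZeros k (suc j) w) ⟩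
    relaxedBlocks₀ (suc k) (suc (suc j)) (w ·00) ∧ lastFlipRejected
      ≡⟨ relaxedBlocks₀-lastFlip (suc k) (suc j) (w ·00) ⟩
    blocks₀ any (suc k) (suc (suc j)) (w ·00) ∎
    where
    open ≡-Reasoning
    zerosRead lastFlipRejected : Bool
    zerosRead        = acceptsMaximal (inZeros (suc k) (suc (suc j))) w
    lastFlipRejected = not (accepts (step (inZeros (suc k) (suc j)) true) (w ·00))
  acceptsMaximal-inZeros k zero (true ∷ w) rewrite acceptsMaximal-dead w = refl
  acceptsMaximal-inZeros k (suc j) (true ∷ w) with k <ᵇ suc j in k<j
  ... | false rewrite acceptsMaximal-dead w with fits any (suc k) (suc (suc j)) in fit
  ...   | false = refl
  ...   | true with trans (sym (fits⇒<ᵇ any (suc k) (suc (suc j)) fit)) k<j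
  ...     | ()
  acceptsMaximal-inZeros k (suc j) (true ∷ w) | true
    rewrite acceptsMaximal-inOnes 0 w | fits-any (suc k) (suc j) | k<j
    with suc k <ᵇ j | blocks₁ any 1 (w ·00) in blocks
  ... | false | _     rewrite accepts-dead (w ·00) = ∧-identityʳ _
  ... | true  | false = refl
  ... | true  | true  rewrite blocks₁⇒accepts any 1 (w ·00) blocks = refl

maxWord₂⇒accepts : ∀ y → maxWord₂ y ≡ true → accepts (inZeros 1 2) y ≡ true
maxWord₂⇒accepts []         _ = refl
maxWord₂⇒accepts (true ∷ y) q = blocks₁⇒accepts odd 1 y q

maxWord₁-flipRejected : ∀ y → maxWord₁ y ≡ maxWord₀ y ∧ not (accepts (inOnes 1) y)
maxWord₁-flipRejected []                  = refl
maxWord₁-flipRejected (true ∷ y)          = blocks₁-odd 1 y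
maxWord₁-flipRejected (false ∷ [])        = refl
maxWord₁-flipRejected (false ∷ true ∷ y)  rewrite accepts-dead y = sym (∧-identityʳ _)
maxWord₁-flipRejected (false ∷ false ∷ y) with maxWord₂ y in max
... | false = refl
... | true  rewrite maxWord₂⇒accepts y max = refl

acceptsMaximal-leading : ∀ w → acceptsMaximal leading w ≡ maxWord₀ (w ·00)
acceptsMaximal-leading []          = refl
acceptsMaximal-leading (true ∷ w)  = acceptsMaximal-inOnes 0 w
acceptsMaximal-leading (false ∷ w) rewrite acceptsMaximal-leading w = sym (maxWord₁-flipRejected (w ·00))

-- Enumerating maximal words

insertZero : ∀ {n} → Vec Bool n → Vec Bool (suc n)
insertZero []          = false ∷ []
insertZero (true ∷ v)  = true ∷ insertZero v
insertZero (false ∷ v) = false ∷ false ∷ v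

insertZeroˡ : List Bool → List Bool
insertZeroˡ []          = false ∷ []
insertZeroˡ (true ∷ x)  = true ∷ insertZeroˡ x
insertZeroˡ (false ∷ x) = false ∷ false ∷ x

toList-insertZero : ∀ {n} (v : Vec Bool n) → toList (insertZero v) ·00 ≡ insertZeroˡ (toList v ·00)
toList-insertZero []          = refl
toList-insertZero (true ∷ v)  = cong (true ∷_) (toList-insertZero v)
toList-insertZero (false ∷ v) = refl

removeZero : ∀ {n} → Vec Bool (suc n) → Vec Bool n
removeZero {zero}  (_ ∷ [])    = []
removeZero {suc n} (true ∷ r)  = true ∷ removeZero r
removeZero {suc n} (false ∷ r) = r

removeZero-insertZero : ∀ {n} (v : Vec Bool n) → removeZero (insertZero v) ≡ v
removeZero-insertZero []          = refl
removeZero-insertZero (true ∷ v)  = cong (true ∷_) (removeZero-insertZero v)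
removeZero-insertZero (false ∷ v) = refl

insertZero-injective : ∀ {n} {u v : Vec Bool n} → insertZero u ≡ insertZero v → u ≡ v
insertZero-injective {u = u} {v} eq =
  trans (sym (removeZero-insertZero u)) (trans (cong removeZero eq) (removeZero-insertZero v))

insertZero-removeZero : ∀ p k {n} (r : Vec Bool (suc n)) →
  blocks₁ p (suc k) (toList r ·00) ≡ true → insertZero (removeZero r) ≡ r
insertZero-removeZero p k {zero}  (false ∷ [])        _ = refl
insertZero-removeZero p k {zero}  (true ∷ [])         q with fits⇒<ᵇ p (suc (suc k)) 2 q
... | ()
insertZero-removeZero p k {suc n} (true ∷ r)          q = cong (true ∷_) (insertZero-removeZero p (suc k) r q)
insertZero-removeZero p k {suc n} (false ∷ false ∷ r) _ = refl
insertZero-removeZero p k {suc n} (false ∷ true ∷ r)  q with fits⇒<ᵇ p (suc k) 1 (∧-conicalˡ _ _ q)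
... | ()

-- Adds a one and a zero to the first block.
widen : ∀ {n} → Vec Bool n → Vec Bool (suc (suc n))
widen v = true ∷ insertZero v

widen-injective : ∀ {n} {u v : Vec Bool n} → widen u ≡ widen v → u ≡ v
widen-injective eq = insertZero-injective (cong tail eq)

fits-suc : ∀ p k j → fits p (suc k) (suc j) ≡ fits p k j
fits-suc odd  k j = refl
fits-suc even k j = refl
fits-suc any  k j = refl

blocks₀-suc : ∀ p k j x → blocks₀ p (suc k) (suc j) x ≡ blocks₀ p k j x
blocks₀-suc p k j []          = fits-suc p k j
blocks₀-suc p k j (false ∷ x) = blocks₀-suc p k (suc j) x
blocks₀-suc p k j (true ∷ x)  = cong (_∧ blocks₁ (nextParity k j) 1 x) (fits-suc p k j)

blocks₁-insertZero : ∀ p k x → blocks₁ p (suc k) (insertZeroˡ x) ≡ blocks₁ p k x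
blocks₁-insertZero odd  k []          = refl
blocks₁-insertZero even k []          = refl
blocks₁-insertZero any  k []          = refl
blocks₁-insertZero p    k (true ∷ x)  = blocks₁-insertZero p (suc k) x
blocks₁-insertZero p    k (false ∷ x) = blocks₀-suc p k 1 x

blockWord : Parity → List Bool → Bool
blockWord p []          = false
blockWord p (true ∷ x)  = blocks₁ p 1 x
blockWord p (false ∷ x) = false

BlockWord : ∀ {n} → Parity → Vec Bool n → Set
BlockWord p w = blockWord p (toList w ·00) ≡ true

blockWord-widen : ∀ p {n} (v : Vec Bool n) → blockWord p (toList (widen v) ·00) ≡ blocks₁ p 0 (toList v ·00)
blockWord-widen p v = trans (cong (blocks₁ p 1) (toList-insertZero v)) (blocks₁-insertZero p 0 (toList v ·00))

widen-sound : ∀ p {n} (v : Vec Bool n) → BlockWord p v → BlockWord p (widen v)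
widen-sound p (true ∷ u) q = trans (blockWord-widen p (true ∷ u)) q

unwiden : ∀ p {n} (r : Vec Bool (suc n)) → BlockWord p (true ∷ true ∷ r) →
          Σ (Vec Bool (suc n)) λ v → widen v ≡ true ∷ true ∷ r × BlockWord p v
unwiden p {n} r q = v , widen-v , trans (sym (blockWord-widen p v)) (subst (BlockWord p) (sym widen-v) q)
  where
  v : Vec Bool (suc n)
  v = true ∷ removeZero r
  widen-v : widen v ≡ true ∷ true ∷ r
  widen-v = cong (λ r′ → true ∷ true ∷ r′) (insertZero-removeZero p 1 r q)

firstLetter : ∀ {n} → Vec Bool n → Bool
firstLetter []      = false
firstLetter (b ∷ _) = b

blockWord⇒firstLetter : ∀ p {n} (w : Vec Bool n) → BlockWord p w → firstLetter w ≡ true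
blockWord⇒firstLetter p (true ∷ _) _ = refl

blockWord-oddBlock : ∀ x → blockWord odd ((true ∷ false ∷ false ∷ x) ·00) ≡ blockWord any (x ·00)
blockWord-oddBlock []                  = refl
blockWord-oddBlock (true ∷ x)          = refl
blockWord-oddBlock (false ∷ [])        = refl
blockWord-oddBlock (false ∷ true ∷ x)  = refl
blockWord-oddBlock (false ∷ false ∷ x) = blocks₀-tooLong odd 1 2 (x ·00) refl

blockWord-evenBlock : ∀ x → blockWord even ((true ∷ false ∷ false ∷ false ∷ x) ·00) ≡ blockWord odd (x ·00)
blockWord-evenBlock []                  = refl
blockWord-evenBlock (true ∷ x)          = refl
blockWord-evenBlock (false ∷ [])        = refl
blockWord-evenBlock (false ∷ true ∷ x)  = refl
blockWord-evenBlock (false ∷ false ∷ x) = blocks₀-tooLong even 1 3 (x ·00) refl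

mutual
  blocks₁-any : ∀ k y → blocks₁ any k y ≡ blocks₁ odd k y ∨ blocks₁ even k y
  blocks₁-any k []          = refl
  blocks₁-any k (true ∷ y)  = blocks₁-any (suc k) y
  blocks₁-any k (false ∷ y) = blocks₀-any k 1 y

  blocks₀-any : ∀ k j y → blocks₀ any k j y ≡ blocks₀ odd k j y ∨ blocks₀ even k j y
  blocks₀-any k j []          = refl
  blocks₀-any k j (false ∷ y) = blocks₀-any k (suc j) y
  blocks₀-any k j (true ∷ y)  = ∧-distribʳ-∨ (blocks₁ (nextParity k j) 1 y) (fits odd k j) (fits even k j)

blockWord-any : ∀ x → blockWord any x ≡ blockWord odd x ∨ blockWord even x
blockWord-any []          = refl
blockWord-any (true ∷ x)  = blocks₁-any 1 x
blockWord-any (false ∷ x) = refl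

blockWord-odd⇒any : ∀ x → blockWord odd x ≡ true → blockWord any x ≡ true
blockWord-odd⇒any x q = trans (blockWord-any x) (cong (_∨ blockWord even x) q)

blockWord-even⇒any : ∀ x → blockWord even x ≡ true → blockWord any x ≡ true
blockWord-even⇒any x q = trans (blockWord-any x) (trans (cong (blockWord odd x ∨_) q) (∨-zeroʳ _))

blockWord-¬odd⇒even : ∀ x → blockWord any x ≡ true → blockWord odd x ≡ false → blockWord even x ≡ true
blockWord-¬odd⇒even x q ¬odd = trans (cong (_∨ blockWord even x) (sym ¬odd)) (trans (sym (blockWord-any x)) q)

fits-odd⇒¬even : ∀ k j → fits odd k j ≡ true → fits even k j ≡ false
fits-odd⇒¬even zero    (suc zero) _ = refl
fits-odd⇒¬even (suc k) (suc j)    q = fits-odd⇒¬even k j q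

mutual
  blocks₁-odd⇒¬even : ∀ k y → blocks₁ odd k y ≡ true → blocks₁ even k y ≡ false
  blocks₁-odd⇒¬even k (true ∷ y)  = blocks₁-odd⇒¬even (suc k) y
  blocks₁-odd⇒¬even k (false ∷ y) = blocks₀-odd⇒¬even k 1 y

  blocks₀-odd⇒¬even : ∀ k j y → blocks₀ odd k j y ≡ true → blocks₀ even k j y ≡ false
  blocks₀-odd⇒¬even k j []          q = fits-odd⇒¬even k j q
  blocks₀-odd⇒¬even k j (false ∷ y) q = blocks₀-odd⇒¬even k (suc j) y q
  blocks₀-odd⇒¬even k j (true ∷ y)  q rewrite fits-odd⇒¬even k j (∧-conicalˡ _ _ q) = refl

blockWord-odd⇒¬even : ∀ x → blockWord odd x ≡ true → blockWord even x ≡ false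
blockWord-odd⇒¬even (true ∷ x) = blocks₁-odd⇒¬even 1 x

oddBlock : Vec Bool 3
oddBlock = true ∷ false ∷ false ∷ []

evenBlock : Vec Bool 4
evenBlock = true ∷ false ∷ false ∷ false ∷ []

-- The words w of length n with w·00 a sequence of blocks, the first one odd / even / of either parity.
mutual
  oddWords : (n : ℕ) → List (Vec Bool n)
  oddWords 0                   = []
  oddWords 1                   = (true ∷ []) ∷ []
  oddWords 2                   = []
  oddWords (suc (suc (suc m))) = map (oddBlock ++ᵛ_) (blockWords m) ++ map widen (oddWords (suc m))

  evenWords : (n : ℕ) → List (Vec Bool n)
  evenWords 0                         = []
  evenWords 1                         = []
  evenWords 2                         = (true ∷ false ∷ []) ∷ []
  evenWords 3                         = []
  evenWords (suc (suc (suc (suc m)))) = map (evenBlock ++ᵛ_) (oddWords m) ++ map widen (evenWords (suc (suc m)))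

  blockWords : (n : ℕ) → List (Vec Bool n)
  blockWords n = oddWords n ++ evenWords n

mutual
  oddWords-sound : ∀ n → All (BlockWord odd) (oddWords n)
  oddWords-sound 0                   = []
  oddWords-sound 1                   = refl ∷ []
  oddWords-sound 2                   = []
  oddWords-sound (suc (suc (suc m))) = All.++⁺
    (All.map⁺ (All.map (λ {v} q → trans (blockWord-oddBlock (toList v)) q) (blockWords-sound m)))
    (All.map⁺ (All.map (λ {v} → widen-sound odd v) (oddWords-sound (suc m))))

  evenWords-sound : ∀ n → All (BlockWord even) (evenWords n)
  evenWords-sound 0                         = []
  evenWords-sound 1                         = []
  evenWords-sound 2                         = refl ∷ []
  evenWords-sound 3                         = []
  evenWords-sound (suc (suc (suc (suc m)))) = All.++⁺
    (All.map⁺ (All.map (λ {v} q → trans (blockWord-evenBlock (toList v)) q) (oddWords-sound m)))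
    (All.map⁺ (All.map (λ {v} → widen-sound even v) (evenWords-sound (suc (suc m)))))

  blockWords-sound : ∀ n → All (BlockWord any) (blockWords n)
  blockWords-sound n = All.++⁺
    (All.map (λ {v} → blockWord-odd⇒any (toList v ·00)) (oddWords-sound n))
    (All.map (λ {v} → blockWord-even⇒any (toList v ·00)) (evenWords-sound n))

mutual
  oddWords-complete : ∀ n (w : Vec Bool n) → BlockWord odd w → w ∈ oddWords n
  oddWords-complete 1 (true ∷ []) _ = here refl
  oddWords-complete 2 (true ∷ true ∷ []) ()
  oddWords-complete 2 (true ∷ false ∷ []) ()
  oddWords-complete (suc (suc (suc m))) (true ∷ true ∷ r) q =
    let v , widen-v , qv = unwiden odd r q in
    ∈-++⁺ʳ (map (oddBlock ++ᵛ_) (blockWords m))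
      (subst (_∈ map widen (oddWords (suc m))) widen-v (∈-map⁺ widen (oddWords-complete (suc m) v qv)))
  oddWords-complete (suc (suc (suc m))) (true ∷ false ∷ false ∷ v) q =
    ∈-++⁺ˡ (∈-map⁺ (oddBlock ++ᵛ_) (blockWords-complete m v (trans (sym (blockWord-oddBlock (toList v))) q)))

  evenWords-complete : ∀ n (w : Vec Bool n) → BlockWord even w → w ∈ evenWords n
  evenWords-complete 1 (true ∷ []) ()
  evenWords-complete 2 (true ∷ true ∷ []) ()
  evenWords-complete 2 (true ∷ false ∷ []) _ = here refl
  evenWords-complete 3 (true ∷ true ∷ true ∷ []) ()
  evenWords-complete 3 (true ∷ true ∷ false ∷ []) ()
  evenWords-complete 3 (true ∷ false ∷ true ∷ []) ()
  evenWords-complete 3 (true ∷ false ∷ false ∷ []) ()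
  evenWords-complete (suc (suc (suc (suc m)))) (true ∷ true ∷ r) q =
    let v , widen-v , qv = unwiden even r q in
    ∈-++⁺ʳ (map (evenBlock ++ᵛ_) (oddWords m))
      (subst (_∈ map widen (evenWords (suc (suc m)))) widen-v (∈-map⁺ widen (evenWords-complete (suc (suc m)) v qv)))
  evenWords-complete (suc (suc (suc (suc m)))) (true ∷ false ∷ true ∷ r) ()
  evenWords-complete (suc (suc (suc (suc m)))) (true ∷ false ∷ false ∷ true ∷ r) ()
  evenWords-complete (suc (suc (suc (suc m)))) (true ∷ false ∷ false ∷ false ∷ v) q =
    ∈-++⁺ˡ (∈-map⁺ (evenBlock ++ᵛ_) (oddWords-complete m v (trans (sym (blockWord-evenBlock (toList v))) q)))

  blockWords-complete : ∀ n (w : Vec Bool n) → BlockWord any w → w ∈ blockWords n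
  blockWords-complete n w q with blockWord odd (toList w ·00) in isOdd
  ... | true  = ∈-++⁺ˡ (oddWords-complete n w isOdd)
  ... | false = ∈-++⁺ʳ (oddWords n) (evenWords-complete n w (blockWord-¬odd⇒even (toList w ·00) q isOdd))

disjointBy : ∀ {A : Set} (f : A → Bool) {b xs ys} →
             All (λ x → f x ≡ b) xs → All (λ y → f y ≡ not b) ys → Disjoint xs ys
disjointBy f fxs fys (v∈xs , v∈ys) = not-¬ (All.lookup fxs v∈xs) (All.lookup fys v∈ys)

secondLetter : ∀ {n} → Vec Bool (suc (suc n)) → Bool
secondLetter w = firstLetter (tail w)

widen-secondLetter : ∀ p {n} (v : Vec Bool (suc n)) → BlockWord p v → secondLetter (widen v) ≡ true
widen-secondLetter p (true ∷ _) _ = refl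

mutual
  oddWords-unique : ∀ n → Unique (oddWords n)
  oddWords-unique 0                   = []
  oddWords-unique 1                   = [] ∷ []
  oddWords-unique 2                   = []
  oddWords-unique (suc (suc (suc m))) = Unique.++⁺
    (Unique.map⁺ (++-injectiveʳ oddBlock oddBlock) (blockWords-unique m))
    (Unique.map⁺ widen-injective (oddWords-unique (suc m)))
    (disjointBy secondLetter (All.map⁺ (All.tabulate λ _ → refl))
      (All.map⁺ (All.map (λ {v} → widen-secondLetter odd v) (oddWords-sound (suc m)))))

  evenWords-unique : ∀ n → Unique (evenWords n)
  evenWords-unique 0                         = []
  evenWords-unique 1                         = []
  evenWords-unique 2                         = [] ∷ []
  evenWords-unique 3                         = []
  evenWords-unique (suc (suc (suc (suc m)))) = Unique.++⁺
    (Unique.map⁺ (++-injectiveʳ evenBlock evenBlock) (oddWords-unique m))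
    (Unique.map⁺ widen-injective (evenWords-unique (suc (suc m))))
    (disjointBy secondLetter (All.map⁺ (All.tabulate λ _ → refl))
      (All.map⁺ (All.map (λ {v} → widen-secondLetter even v) (evenWords-sound (suc (suc m))))))

  blockWords-unique : ∀ n → Unique (blockWords n)
  blockWords-unique n = Unique.++⁺ (oddWords-unique n) (evenWords-unique n)
    (disjointBy (λ w → blockWord even (toList w ·00))
      (All.map (λ {v} → blockWord-odd⇒¬even (toList v ·00)) (oddWords-sound n)) (evenWords-sound n))

leadingZeroWords : (n : ℕ) → List (Vec Bool n)
leadingZeroWords 0             = [] ∷ []
leadingZeroWords 1             = []
leadingZeroWords (suc (suc m)) = map (false ∷_) (oddWords (suc m)) ++ map ((false ∷ false ∷ []) ++ᵛ_) (oddWords m)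

maximalWords : (n : ℕ) → List (Vec Bool n)
maximalWords n = blockWords n ++ leadingZeroWords n

maximalWords-unique : ∀ n → Unique (maximalWords n)
maximalWords-unique n = Unique.++⁺ (blockWords-unique n) (leadingZeroWords-unique n)
  (disjointBy firstLetter (All.map (λ {v} → blockWord⇒firstLetter any v) (blockWords-sound n)) (startWithZero n))
  where
  startWithZero : ∀ n → All (λ w → firstLetter w ≡ false) (leadingZeroWords n)
  startWithZero 0             = refl ∷ []
  startWithZero 1             = []
  startWithZero (suc (suc m)) = All.++⁺ (All.map⁺ {xs = oddWords (suc m)} (All.tabulate λ _ → refl))
                                        (All.map⁺ {xs = oddWords m} (All.tabulate λ _ → refl))

  leadingZeroWords-unique : ∀ n → Unique (leadingZeroWords n)
  leadingZeroWords-unique 0             = [] ∷ []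
  leadingZeroWords-unique 1             = []
  leadingZeroWords-unique (suc (suc m)) = Unique.++⁺
    (Unique.map⁺ ∷-injectiveʳ (oddWords-unique (suc m)))
    (Unique.map⁺ (++-injectiveʳ (false ∷ false ∷ []) (false ∷ false ∷ [])) (oddWords-unique m))
    (disjointBy secondLetter (All.map⁺ (All.map (λ {v} → blockWord⇒firstLetter odd v) (oddWords-sound (suc m))))
      (All.map⁺ (All.tabulate λ _ → refl)))

maximalWords-sound : ∀ n → All (λ w → maxWord₀ (toList w ·00) ≡ true) (maximalWords n)
maximalWords-sound n =
  All.++⁺ (All.map (λ {w} → blockWord⇒maxWord₀ w) (blockWords-sound n)) (leadingZeroWords-sound n)
  where
  blockWord⇒maxWord₀ : ∀ {n} (w : Vec Bool n) → BlockWord any w → maxWord₀ (toList w ·00) ≡ true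
  blockWord⇒maxWord₀ (true ∷ _) q = q

  leadingZeroWords-sound : ∀ n → All (λ w → maxWord₀ (toList w ·00) ≡ true) (leadingZeroWords n)
  leadingZeroWords-sound 0             = refl ∷ []
  leadingZeroWords-sound 1             = []
  leadingZeroWords-sound (suc (suc m)) = All.++⁺
    (All.map⁺ (All.map (λ {v} → oneZero v) (oddWords-sound (suc m))))
    (All.map⁺ (All.map (λ {v} → twoZeros v) (oddWords-sound m)))
    where
    oneZero : ∀ {n} (v : Vec Bool n) → BlockWord odd v → maxWord₁ (toList v ·00) ≡ true
    oneZero (true ∷ _) q = q
    twoZeros : ∀ {n} (v : Vec Bool n) → BlockWord odd v → maxWord₂ (toList v ·00) ≡ true
    twoZeros (true ∷ _) q = q

maximalWords-complete : ∀ n (w : Vec Bool n) → maxWord₀ (toList w ·00) ≡ true → w ∈ maximalWords n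
maximalWords-complete 0 [] _ = here refl
maximalWords-complete n (true ∷ u) q = ∈-++⁺ˡ (blockWords-complete n (true ∷ u) q)
maximalWords-complete (suc (suc m)) (false ∷ true ∷ u) q =
  ∈-++⁺ʳ (blockWords (suc (suc m))) (∈-++⁺ˡ (∈-map⁺ (false ∷_) (oddWords-complete (suc m) (true ∷ u) q)))
maximalWords-complete (suc (suc (suc m))) (false ∷ false ∷ true ∷ u) q =
  ∈-++⁺ʳ (blockWords (suc (suc (suc m))))
    (∈-++⁺ʳ (map (false ∷_) (oddWords (suc (suc m)))) (∈-map⁺ _ (oddWords-complete (suc m) (true ∷ u) q)))

∈maximalWords⇔maximal : ∀ n (w : Vec Bool n) →
  (w ∈ maximalWords n) ⇔ (Σ (IsVertex n w) λ p → Maximal n (w , p))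
∈maximalWords⇔maximal n w = ⇔.trans
  (mk⇔ (λ w∈ → trans (acceptsMaximal-leading (toList w)) (All.lookup (maximalWords-sound n) w∈))
       (λ q → maximalWords-complete n w (trans (sym (acceptsMaximal-leading (toList w))) q)))
  (⇔.sym (maximalVertex⇔acceptsMaximal n w))

-- Counting and the generating function

module _ where

  open import Data.Nat using (_+_)
  open import Data.Nat.Tactic.RingSolver using (solve-∀)

  mutual
    oddCount : ℕ → ℕ
    oddCount 0                   = 0
    oddCount 1                   = 1
    oddCount 2                   = 0
    oddCount (suc (suc (suc m))) = blockCount m + oddCount (suc m)

    evenCount : ℕ → ℕ
    evenCount 0                         = 0
    evenCount 1                         = 0
    evenCount 2                         = 1
    evenCount 3                         = 0
    evenCount (suc (suc (suc (suc m)))) = oddCount m + evenCount (suc (suc m))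

    blockCount : ℕ → ℕ
    blockCount n = oddCount n + evenCount n

  length-++-map : ∀ {A B C : Set} (f : A → C) (g : B → C) xs ys →
                  length (map f xs ++ map g ys) ≡ length xs + length ys
  length-++-map f g xs ys = trans (length-++ (map f xs)) (cong₂ _+_ (length-map f xs) (length-map g ys))

  mutual
    length-oddWords : ∀ n → length (oddWords n) ≡ oddCount n
    length-oddWords 0                   = refl
    length-oddWords 1                   = refl
    length-oddWords 2                   = refl
    length-oddWords (suc (suc (suc m))) =
      trans (length-++-map (oddBlock ++ᵛ_) widen (blockWords m) (oddWords (suc m)))
            (cong₂ _+_ (length-blockWords m) (length-oddWords (suc m)))

    length-evenWords : ∀ n → length (evenWords n) ≡ evenCount n
    length-evenWords 0                         = refl
    length-evenWords 1                         = refl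
    length-evenWords 2                         = refl
    length-evenWords 3                         = refl
    length-evenWords (suc (suc (suc (suc m)))) =
      trans (length-++-map (evenBlock ++ᵛ_) widen (oddWords m) (evenWords (suc (suc m))))
            (cong₂ _+_ (length-oddWords m) (length-evenWords (suc (suc m))))

    length-blockWords : ∀ n → length (blockWords n) ≡ blockCount n
    length-blockWords n = trans (length-++ (oddWords n)) (cong₂ _+_ (length-oddWords n) (length-evenWords n))

  leadingZeroCount : ℕ → ℕ
  leadingZeroCount 0             = 1
  leadingZeroCount 1             = 0
  leadingZeroCount (suc (suc m)) = oddCount (suc m) + oddCount m

  maximalCount : ℕ → ℕ
  maximalCount n = blockCount n + leadingZeroCount n

  length-maximalWords : ∀ n → length (maximalWords n) ≡ maximalCount n
  length-maximalWords n = trans (length-++ (blockWords n)) (cong₂ _+_ (length-blockWords n) (length-leadingZeroWords n))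
    where
    length-leadingZeroWords : ∀ n → length (leadingZeroWords n) ≡ leadingZeroCount n
    length-leadingZeroWords 0             = refl
    length-leadingZeroWords 1             = refl
    length-leadingZeroWords (suc (suc m)) = trans (length-++-map _ _ (oddWords (suc m)) (oddWords m))
      (cong₂ _+_ (length-oddWords (suc m)) (length-oddWords m))

  maximalCount-recurrence : ∀ m →
    maximalCount (9 + m) + maximalCount (5 + m) + maximalCount (4 + m)
      ≡ maximalCount (7 + m) + maximalCount (7 + m) + maximalCount (6 + m) + maximalCount (2 + m)
  maximalCount-recurrence m =
    recurrence (oddCount m) (oddCount (1 + m)) (oddCount (2 + m))
               (evenCount m) (evenCount (1 + m)) (evenCount (2 + m)) (evenCount (3 + m))
    where
    -- oₖ = oddCount (k + m) and eₖ = evenCount (k + m), unfolded by their defining recurrences.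
    recurrence : ∀ o₀ o₁ o₂ e₀ e₁ e₂ e₃ →
      let o₃ = (o₀ + e₀) + o₁ ; e₄ = o₀ + e₂
          o₄ = (o₁ + e₁) + o₂ ; e₅ = o₁ + e₃
          o₅ = (o₂ + e₂) + o₃ ; e₆ = o₂ + e₄
          o₆ = (o₃ + e₃) + o₄ ; e₇ = o₃ + e₅
          o₇ = (o₄ + e₄) + o₅ ; e₈ = o₄ + e₆
          o₈ = (o₅ + e₅) + o₆ ; e₉ = o₅ + e₇
          o₉ = (o₆ + e₆) + o₇
          count : ℕ → ℕ → ℕ → ℕ → ℕ
          count oₖ eₖ oₖ₋₁ oₖ₋₂ = (oₖ + eₖ) + (oₖ₋₁ + oₖ₋₂)
      in count o₉ e₉ o₈ o₇ + count o₅ e₅ o₄ o₃ + count o₄ e₄ o₃ o₂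
           ≡ count o₇ e₇ o₆ o₅ + count o₇ e₇ o₆ o₅ + count o₆ e₆ o₅ o₄ + count o₂ e₂ o₁ o₀
    recurrence = solve-∀

module _ where

  import Data.Nat as ℕ
  open import Data.Nat.Properties using (+-suc; +-identityʳ)
  open import Data.Integer using (ℤ; +_; -[1+_]; _+_; _*_; _-_)
  import Data.Integer.Properties as ℤ
  open import Data.Integer.Tactic.RingSolver using (solve-∀)

  sumUpTo-stable : ∀ (g : ℕ → ℤ) n → (∀ i → g (suc (n ℕ.+ i)) ≡ + 0) →
                   ∀ m → sumUpTo (n ℕ.+ m) g ≡ sumUpTo n g
  sumUpTo-stable g n vanish zero    rewrite +-identityʳ n = refl
  sumUpTo-stable g n vanish (suc m) rewrite +-suc n m =
    trans (cong (λ x → sumUpTo (n ℕ.+ m) g + x) (vanish m)) (trans (ℤ.+-identityʳ _) (sumUpTo-stable g n vanish m))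

  -- The coefficient of t^(m+9) in denom · Σ Mₙtⁿ, where aᵢ = M_(m+i).
  denom-recurrence : ∀ a₉ a₈ a₇ a₆ a₅ a₄ a₃ a₂ → a₉ ℕ.+ a₅ ℕ.+ a₄ ≡ a₇ ℕ.+ a₇ ℕ.+ a₆ ℕ.+ a₂ →
    + 1 * + a₉ + + 0 * + a₈ + -[1+ 1 ] * + a₇ + -[1+ 0 ] * + a₆ + + 1 * + a₅ + + 1 * + a₄ + + 0 * + a₃ + -[1+ 0 ] * + a₂
      ≡ + 0
  denom-recurrence a₉ a₈ a₇ a₆ a₅ a₄ a₃ a₂ rec = begin
    + 1 * + a₉ + + 0 * + a₈ + -[1+ 1 ] * + a₇ + -[1+ 0 ] * + a₆ + + 1 * + a₅ + + 1 * + a₄ + + 0 * + a₃ + -[1+ 0 ] * + a₂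
      ≡⟨ regroup (+ a₉) (+ a₈) (+ a₇) (+ a₆) (+ a₅) (+ a₄) (+ a₃) (+ a₂) ⟩
    (+ a₉ + + a₅ + + a₄) - (+ a₇ + + a₇ + + a₆ + + a₂)
      ≡⟨ cong₂ _-_ (sym (+-sum₃ a₉ a₅ a₄)) (sym (+-sum₄ a₇ a₇ a₆ a₂)) ⟩
    + (a₉ ℕ.+ a₅ ℕ.+ a₄) - + rhs
      ≡⟨ cong (λ x → + x - + rhs) rec ⟩
    + rhs - + rhs
      ≡⟨ ℤ.+-inverseʳ (+ rhs) ⟩
    + 0 ∎
    where
    open ≡-Reasoning
    rhs : ℕ
    rhs = a₇ ℕ.+ a₇ ℕ.+ a₆ ℕ.+ a₂
    +-sum₃ : ∀ a b c → + (a ℕ.+ b ℕ.+ c) ≡ + a + + b + + c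
    +-sum₃ a b c = trans (ℤ.pos-+ (a ℕ.+ b) c) (cong (_+ + c) (ℤ.pos-+ a b))
    +-sum₄ : ∀ a b c d → + (a ℕ.+ b ℕ.+ c ℕ.+ d) ≡ + a + + b + + c + + d
    +-sum₄ a b c d = trans (ℤ.pos-+ (a ℕ.+ b ℕ.+ c) d) (cong (_+ + d) (+-sum₃ a b c))
    regroup : ∀ a₉ a₈ a₇ a₆ a₅ a₄ a₃ a₂ →
      + 1 * a₉ + + 0 * a₈ + -[1+ 1 ] * a₇ + -[1+ 0 ] * a₆ + + 1 * a₅ + + 1 * a₄ + + 0 * a₃ + -[1+ 0 ] * a₂
        ≡ (a₉ + a₅ + a₄) - (a₇ + a₇ + a₆ + a₂)
    regroup = solve-∀

  maximalCount-series : ∀ k → cauchy denom (seriesFrom1 maximalCount) k ≡ numer k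
  maximalCount-series 0 = refl
  maximalCount-series 1 = refl
  maximalCount-series 2 = refl
  maximalCount-series 3 = refl
  maximalCount-series 4 = refl
  maximalCount-series 5 = refl
  maximalCount-series 6 = refl
  maximalCount-series 7 = refl
  maximalCount-series 8 = refl
  maximalCount-series (suc (suc (suc (suc (suc (suc (suc (suc (suc m))))))))) =
    trans (sumUpTo-stable (λ i → denom i * seriesFrom1 maximalCount (9 ℕ.+ m ℕ.∸ i)) 7 (λ _ → refl) (2 ℕ.+ m))
          (denom-recurrence (M 9) (M 8) (M 7) (M 6) (M 5) (M 4) (M 3) (M 2) (maximalCount-recurrence m))
    where
    M : ℕ → ℕ
    M i = maximalCount (i ℕ.+ m)

corollary7p1 : Σ (ℕ → ℕ) λ M →
    ((n : ℕ) → Σ (List (Vec Bool (suc n))) λ L →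
    Unique L × length L ≡ M (suc n) ×
    ((w : Vec Bool (suc n)) →
    (w ∈ L) ⇔ (Σ (IsVertex (suc n) w) λ p → Maximal (suc n) (w , p))))
    × ((k : ℕ) → cauchy denom (seriesFrom1 M) k ≡ numer k)
corollary7p1 =
  maximalCount ,
  (λ n → maximalWords (suc n) , maximalWords-unique (suc n) , length-maximalWords (suc n) ,
         ∈maximalWords⇔maximal (suc n)) ,
  maximalCount-series
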